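{- Let $n\ge2$, $1\le\ell\le n-1$, $p$ a prime, and $\phi$ a Maass form for $\mathrm{SL}(n,\mathbb Z)$ with arithmetic Fourier coefficients $A_\phi$ normalized by $A_\phi(1,\ldots,1)=1$. Let $\mathcal C_\ell$ be the set of compositions of $\ell$, i.e. ordered tuples $(i_1,\ldots,i_r)$ ($r\ge1$) of positive integers with $i_1+\cdots+i_r=\ell$. Then, writing $A_\phi(1,\ldots,1,p,1,\ldots,1)$ for the coefficient whose $\ell$-th argument is $p$ and all other arguments are $1$, $$A_\phi(1,\ldots,1,p,1,\ldots,1)=\sum_{(i_1,\ldots,i_r)\in\mathcal C_\ell}\ \prod_{j=1}^r(-1)^{i_j+1}A_\phi(p^{i_j},1,\ldots,1).$$ Equivalently, this coefficient is the eigenvalue on $\phi$ of the Hecke operator $\sum_{(i_1,\ldots,i_r)\in\mathcal C_\ell}\prod_{j=1}^r(-1)^{i_j+1}T_{p^{i_j}}$.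
   Context: $A_\phi(m_1,\ldots,m_{n-1})$ ($m_1,\ldots,m_{n-2}\ge1$, $m_{n-1}\ne0$ integers) denote the arithmetic Fourier coefficients of a Maass form $\phi$ for $\mathrm{SL}(n,\mathbb Z)$ (smooth automorphic function of moderate growth on $\mathrm{GL}(n,\mathbb R)/(\mathrm O(n,\mathbb R)\mathbb R^\times)$, joint eigenfunction of invariant differential operators and Hecke operators). For each positive integer $m$ there is a Hecke operator $T_m$ with $T_m\phi=A_\phi(m,1,\ldots,1)\phi$. The coefficients satisfy the known Hecke relation: for every positive integer $m$, $$A_\phi(m,1,\ldots,1)A_\phi(m_1,\ldots,m_{n-1})=\sum_{\substack{c_1\cdots c_n=m\\ c_i\mid m_i\ (1\le i\le n-1)}}A_\phi\Big(\frac{m_1c_n}{c_1},\frac{m_2c_1}{c_2},\ldots,\frac{m_{n-1}c_{n-2}}{c_{n-1}}\Big).$$ -}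

module Defs where

open import Level using (Level)
open import Data.Bool using (if_then_else_)
open import Data.Nat using (ℕ; zero; suc; _≟_; _∸_; _/_)
import Data.Nat as ℕ
open import Data.Nat.ListAction using (sum; product)
open import Data.Nat.Divisibility using (_∣_; _∣?_)
open import Data.Fin using (Fin; toℕ)
open import Data.Fin.Properties using (all?)
open import Data.Vec using (Vec; lookup; tabulate)
open import Data.List using (List; []; _∷_; [_]; map; concatMap; filter; foldr; upTo)
open import Data.Product using (_×_)
open import Relation.Nullary.Decidable using (_×-dec_)
open import Algebra.Bundles using (CommutativeRing)

range : ℕ → ℕ → List ℕ
range lo hi = map (λ i → lo Data.Nat.+ i) (upTo (suc hi ∸ lo))

divisors : ℕ → List ℕ
divisors m = filter (λ d → d ∣? m) (range 1 m)

tuples : ℕ → List ℕ → List (List ℕ)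
tuples zero    ds = [ [] ]
tuples (suc l) ds = concatMap (λ d → map (d ∷_) (tuples l ds)) ds

getD : List ℕ → ℕ → ℕ
getD []       _       = 1
getD (x ∷ xs) zero    = x
getD (x ∷ xs) (suc i) = getD xs i

-- exact quotient (only used with nonzero divisors)
_÷_ : ℕ → ℕ → ℕ
m ÷ zero  = 0
m ÷ suc d = m / suc d

heckeTuples : (n m : ℕ) → Vec ℕ (n ∸ 1) → List (List ℕ)
heckeTuples n m mv =
  filter (λ c → (product c ≟ m) ×-dec all? (λ j → getD c (toℕ j) ∣? lookup mv j))
         (tuples n (divisors m))

-- index of c preceding position j cyclically: c_{j-1}, with c_{-1} := c_{n-1} (i.e. c_n)
prevIx : ℕ → ℕ → ℕ
prevIx n zero    = n ∸ 1
prevIx n (suc j) = j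

-- (m_1 c_n / c_1, m_2 c_1 / c_2, ..., m_{n-1} c_{n-2} / c_{n-1})
heckeIndex : (n : ℕ) → Vec ℕ (n ∸ 1) → List ℕ → Vec ℕ (n ∸ 1)
heckeIndex n mv c =
  tabulate (λ j → (lookup mv j ℕ.* getD c (prevIx n (toℕ j))) ÷ getD c (toℕ j))

firstIx : (n m : ℕ) → Vec ℕ (n ∸ 1)
firstIx n m = tabulate (λ j → f (toℕ j))
  where f : ℕ → ℕ
        f zero    = m
        f (suc _) = 1

slotIx : (n ℓ p : ℕ) → Vec ℕ (n ∸ 1)
slotIx n ℓ p = tabulate (λ j → if suc (toℕ j) ℕ.≡ᵇ ℓ then p else 1)

-- the set 𝒞_ℓ of compositions of ℓ: tuples (i_1,...,i_r), r ≥ 1, i_j ≥ 1, Σ i_j = ℓ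
-- (necessarily r ≤ ℓ and each i_j ≤ ℓ, so this enumeration lists each exactly once)
compositions : ℕ → List (List ℕ)
compositions ℓ =
  filter (λ c → sum c ≟ ℓ) (concatMap (λ r → tuples r (range 1 ℓ)) (range 1 ℓ))

module _ {a r : Level} (R : CommutativeRing a r) where
  open CommutativeRing R

  rsum : List Carrier → Carrier
  rsum = foldr _+_ 0#

  rprod : List Carrier → Carrier
  rprod = foldr _*_ 1#

  negOnePow : ℕ → Carrier
  negOnePow zero    = 1#
  negOnePow (suc k) = (- 1#) * negOnePow k

  HeckeRelation : (n : ℕ) → (Vec ℕ (n ∸ 1) → Carrier) → Set r
  HeckeRelation n A =
    (m : ℕ) → 1 Data.Nat.≤ m → (mv : Vec ℕ (n ∸ 1)) → (∀ j → 1 Data.Nat.≤ lookup mv j) →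
    A (firstIx n m) * A mv ≈ rsum (map (λ c → A (heckeIndex n mv c)) (heckeTuples n m mv))

{-# OPTIONS --safe #-}

-- Write h_i = A(p^i,1,…,1), e_k for the coefficient with p in slot k (e_0 = 1), and
-- hook(i,k) for A at (p^i,1,…,1) with its k-th entry multiplied by p. For m = p^(i+1)
-- at a slot index only two tuples (c_j) meet the side conditions of the Hecke relation,
-- which therefore reads h_(i+1) e_k = hook(i+1,k) + hook(i,k+1): Pieri's rule for hook
-- Schur polynomials. As hook(0,s) = e_s and hook(s-1,1) = h_s, the alternating sum of
-- these relations telescopes to e_s = Σ_(i<s) (-1)^i h_(i+1) e_(s-1-i), and unfolding
-- this recursion along the first part expresses e_ℓ as the signed sum over compositions.
module Submission where

open import Defs
open import Level using (Level)
open import Algebra.Bundles using (CommutativeRing)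
open import Data.Bool using (true; false; if_then_else_)
open import Data.Bool.Properties using (if-eta)
open import Data.Nat
  using (ℕ; zero; suc; pred; >-nonZero⁻¹; _∸_; _^_; _≤_; _<_; z≤n; s≤s; z<s; s<s; _≟_; _≡ᵇ_; _/_; NonZero)
import Data.Nat as ℕ
import Data.Nat.Properties as ℕ
open import Data.Nat.Properties
  using ( suc-injective; suc-pred; +-cancelˡ-≡; <⇒≢; <⇒≤; ≤-refl; ≤-trans; m<n⇒m<1+n; m≤n⇒m<n∨m≡n; m≤m+n
        ; m∸n≤m; m^n≢0; m^n>0; m+n∸m≡n; m+[n∸m]≡n; +-∸-assoc; m<n⇒0<n∸m; n∸n≡0; m+n∸n≡m )
open import Data.Nat.DivMod using (n/1≡n; m*n/n≡m)
open import Data.Nat.Divisibility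
  using (_∣_; divides; _∣?_; ∣⇒≤; 0∣⇒≡0; ∣1⇒≡1; ∣-refl; ∣-trans; 1∣_; m∣m*n)
open import Data.Nat.Primality using (Prime; prime⇒nonZero; prime⇒irreducible; ¬prime[1])
open import Data.Fin using (toℕ; fromℕ<)
open import Data.Fin.Properties using (all?; toℕ<n; toℕ-fromℕ<)
open import Data.Vec using (Vec; lookup; tabulate; replicate)
open import Data.Vec.Properties using (lookup∘tabulate; tabulate-cong)
open import Data.Nat.ListAction using (sum; product)
open import Data.List using (List; []; _∷_; [_]; _++_; map; concatMap; length; filter; applyUpTo; cartesianProductWith)
import Data.List as List
open import Data.List.Properties using (∷-injective; filter-++; filter-none; filter-≐; map-++; map-∘; map-applyUpTo)
open import Data.List.Relation.Unary.All using (All; []; _∷_; universal)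
open import Data.List.Relation.Unary.All.Properties using (++⁺; replicate⁺)
open import Data.List.Relation.Unary.Any using (here; there)
open import Data.List.Membership.Propositional using (_∈_)
open import Data.List.Membership.Propositional.Properties
  using (∈-filter⁺; ∈-filter⁻; ∈-map⁺; ∈-upTo⁺; ∈-cartesianProductWith⁺; ∈-cartesianProductWith⁻)
open import Data.List.Relation.Unary.Unique.Propositional using (Unique)
open import Data.List.Relation.Unary.Unique.Propositional.Properties as Unique using (cartesianProductWith⁺)
open import Data.List.Relation.Unary.AllPairs using ([]; _∷_)
open import Data.List.Relation.Binary.BagAndSetEquality using (_∼[_]_; set; ∼bag⇒↭)
open import Data.List.Membership.Propositional.Properties.WithK using (unique∧set⇒bag)
open import Data.List.Relation.Binary.Permutation.Propositional using (↭⇒↭ₛ′)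
open import Data.List.Relation.Binary.Permutation.Propositional.Properties using () renaming (map⁺ to ↭-map⁺)
open import Data.List.Relation.Binary.Permutation.Setoid.Properties using (foldr-commMonoid)
open import Data.Product using (_×_; _,_)
open import Data.Sum using (_⊎_; inj₁; inj₂)
open import Function using (_∘_; id)
open import Function.Bundles using (mk⇔)
open import Relation.Nullary using (contradiction; does; yes; no)
open import Relation.Nullary.Decidable using (_×-dec_; dec-true; dec-false)
open import Relation.Unary using (Decidable; _≐_)
import Relation.Binary.Reasoning.Setoid as SetoidReasoning
import Algebra.Properties.Ring as RingProperties
open import Relation.Binary.PropositionalEquality using (_≡_; _≢_; refl; sym; trans; cong; cong₂; subst; subst₂)

filter-concatMap : ∀ {A B : Set} {P : B → Set} (P? : Decidable P) (f : A → List B) xs →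
                   filter P? (concatMap f xs) ≡ concatMap (filter P? ∘ f) xs
filter-concatMap P? f []       = refl
filter-concatMap P? f (x ∷ xs) =
  trans (filter-++ P? (f x) (concatMap f xs)) (cong (filter P? (f x) ++_) (filter-concatMap P? f xs))

filter-map : ∀ {A B : Set} {P : B → Set} (P? : Decidable P) (f : A → B) xs →
             filter P? (map f xs) ≡ map f (filter (P? ∘ f) xs)
filter-map P? f []       = refl
filter-map P? f (x ∷ xs) with does (P? (f x))
... | true  = cong (f x ∷_) (filter-map P? f xs)
... | false = filter-map P? f xs

tuples-suc : ∀ l ds → tuples (suc l) ds ≡ cartesianProductWith _∷_ ds (tuples l ds)
tuples-suc l ds = go ds
  where
  go : ∀ es → concatMap (λ d → map (d ∷_) (tuples l ds)) es ≡ cartesianProductWith _∷_ es (tuples l ds)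
  go []       = refl
  go (e ∷ es) = cong (map (e ∷_) (tuples l ds) ++_) (go es)

∈-tuples : ∀ {ds} {xs : List ℕ} → All (_∈ ds) xs → xs ∈ tuples (length xs) ds
∈-tuples []                 = here refl
∈-tuples {ds} {_ ∷ xs} (x∈ds ∷ xs∈ds) =
  subst (_ ∈_) (sym (tuples-suc (length xs) ds)) (∈-cartesianProductWith⁺ _∷_ x∈ds (∈-tuples xs∈ds))

∈-tuples⇒length : ∀ l ds {xs : List ℕ} → xs ∈ tuples l ds → length xs ≡ l
∈-tuples⇒length zero    ds (here refl) = refl
∈-tuples⇒length (suc l) ds xs∈
  with ∈-cartesianProductWith⁻ _∷_ ds (tuples l ds) (subst (_ ∈_) (tuples-suc l ds) xs∈)
... | _ , _ , _ , ys∈ , refl = cong suc (∈-tuples⇒length l ds ys∈)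

tuples-unique : ∀ l {ds} → Unique ds → Unique (tuples l ds)
tuples-unique zero    _   = [] ∷ []
tuples-unique (suc l) {ds} ds! = subst Unique (sym (tuples-suc l ds))
  (cartesianProductWith⁺ _∷_ ∷-injective ds! (tuples-unique l ds!))

∈-divisors : ∀ {m d} → .{{NonZero m}} → d ∣ m → d ∈ divisors m
∈-divisors {suc m} {zero}  d∣m with () ← 0∣⇒≡0 d∣m
∈-divisors {suc m} {suc d} d∣m = ∈-filter⁺ (_∣? suc m) (∈-map⁺ suc (∈-upTo⁺ (∣⇒≤ d∣m))) d∣m

divisors-unique : ∀ m → Unique (divisors m)
divisors-unique m = Unique.filter⁺ (_∣? m) (Unique.map⁺ (+-cancelˡ-≡ 1 _ _) (Unique.upTo⁺ m))

heckeTuple : ℕ → ℕ → ℕ → ℕ → List ℕ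
heckeTuple K M a b = List.replicate K 1 ++ a ∷ List.replicate M 1 ++ [ b ]

length-ones-++-last : ∀ M b → length (List.replicate M 1 ++ [ b ]) ≡ suc M
length-ones-++-last zero    b = refl
length-ones-++-last (suc M) b = cong suc (length-ones-++-last M b)

getD-ones-++-last : ∀ M b → getD (List.replicate M 1 ++ [ b ]) M ≡ b
getD-ones-++-last zero    b = refl
getD-ones-++-last (suc M) b = getD-ones-++-last M b

getD-ones-++-other : ∀ M b {j} → j ≢ M → getD (List.replicate M 1 ++ [ b ]) j ≡ 1
getD-ones-++-other zero    b {zero}  j≢M = contradiction refl j≢M
getD-ones-++-other zero    b {suc j} j≢M = refl
getD-ones-++-other (suc M) b {zero}  j≢M = refl
getD-ones-++-other (suc M) b {suc j} j≢M = getD-ones-++-other M b (j≢M ∘ cong suc)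

≡-ones-++-last : ∀ M {xs} → length xs ≡ suc M → (∀ j → j < M → getD xs j ≡ 1) →
                 xs ≡ List.replicate M 1 ++ [ getD xs M ]
≡-ones-++-last zero    {x ∷ []}    _   _    = refl
≡-ones-++-last (suc M) {x ∷ xs}    len ones =
  cong₂ _∷_ (ones 0 z<s) (≡-ones-++-last M (suc-injective len) (λ j j<M → ones (suc j) (s<s j<M)))

length-heckeTuple : ∀ K M a b → length (heckeTuple K M a b) ≡ suc (K ℕ.+ suc M)
length-heckeTuple zero    M a b = cong suc (length-ones-++-last M b)
length-heckeTuple (suc K) M a b = cong suc (length-heckeTuple K M a b)

product-heckeTuple : ∀ K M a b → product (heckeTuple K M a b) ≡ a ℕ.* b
product-heckeTuple (suc K) M a b = trans (ℕ.+-identityʳ _) (product-heckeTuple K M a b)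
product-heckeTuple zero    M a b = cong (a ℕ.*_) (product-ones M)
  where
  product-ones : ∀ M → product (List.replicate M 1 ++ [ b ]) ≡ b
  product-ones zero    = ℕ.*-identityʳ b
  product-ones (suc M) = trans (ℕ.+-identityʳ _) (product-ones M)

All-heckeTuple : ∀ {P : ℕ → Set} K M {a b} → P 1 → P a → P b → All P (heckeTuple K M a b)
All-heckeTuple K M p1 pa pb = ++⁺ (replicate⁺ K p1) (pa ∷ ++⁺ (replicate⁺ M p1) (pb ∷ []))

getD-heckeTuple-slot : ∀ K M a b → getD (heckeTuple K M a b) K ≡ a
getD-heckeTuple-slot zero    M a b = refl
getD-heckeTuple-slot (suc K) M a b = getD-heckeTuple-slot K M a b

getD-heckeTuple-last : ∀ K M a b → getD (heckeTuple K M a b) (K ℕ.+ suc M) ≡ b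
getD-heckeTuple-last zero    M a b = getD-ones-++-last M b
getD-heckeTuple-last (suc K) M a b = getD-heckeTuple-last K M a b

getD-heckeTuple-other : ∀ K M a b {j} → j ≢ K → j ≢ K ℕ.+ suc M → getD (heckeTuple K M a b) j ≡ 1
getD-heckeTuple-other zero    M a b {zero}  j≢K _    = contradiction refl j≢K
getD-heckeTuple-other zero    M a b {suc j} _   j≢N  = getD-ones-++-other M b (j≢N ∘ cong suc)
getD-heckeTuple-other (suc K) M a b {zero}  _   _    = refl
getD-heckeTuple-other (suc K) M a b {suc j} j≢K j≢N  =
  getD-heckeTuple-other K M a b (j≢K ∘ cong suc) (j≢N ∘ cong suc)

≡-heckeTuple : ∀ K M {xs} → length xs ≡ suc (K ℕ.+ suc M) →
               (∀ j → j < K ℕ.+ suc M → j ≢ K → getD xs j ≡ 1) →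
               xs ≡ heckeTuple K M (getD xs K) (getD xs (K ℕ.+ suc M))
≡-heckeTuple zero    M {x ∷ xs} len ones =
  cong (x ∷_) (≡-ones-++-last M (suc-injective len) (λ j j<M → ones (suc j) (s<s j<M) (λ ())))
≡-heckeTuple (suc K) M {x ∷ xs} len ones =
  cong₂ _∷_ (ones 0 z<s (λ ()))
    (≡-heckeTuple K M (suc-injective len) (λ j j<N j≢K → ones (suc j) (s<s j<N) (j≢K ∘ suc-injective)))

if-≟-refl : ∀ {A : Set} n {x y : A} → (if does (n ≟ n) then x else y) ≡ x
if-≟-refl n {x} {y} = cong (λ β → if β then x else y) (dec-true (n ≟ n) refl)

if-≟-≢ : ∀ {A : Set} {m n} {x y : A} → m ≢ n → (if does (m ≟ n) then x else y) ≡ y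
if-≟-≢ {m = m} {n} {x} {y} m≢n = cong (λ β → if β then x else y) (dec-false (m ≟ n) m≢n)

headOr1 : ℕ → ℕ → ℕ
headOr1 x zero    = x
headOr1 x (suc _) = 1

firstIx-suc : ∀ N m → firstIx (suc N) m ≡ tabulate (λ j → headOr1 m (toℕ j))
firstIx-suc zero    m = refl
firstIx-suc (suc N) m = refl

*÷-cancelˡ : ∀ d .{{_ : NonZero d}} x → (d ℕ.* x) ÷ d ≡ x
*÷-cancelˡ d x = subst (λ d → (d ℕ.* x) ÷ d ≡ x) (suc-pred d)
  (trans (cong (_/ suc (pred d)) (ℕ.*-comm (suc (pred d)) x)) (m*n/n≡m x (suc (pred d))))

-- Entries of the Hecke index of the two admissible tuples, with β = (j = K) and γ = (j = K + 1).
÷-slot-trivial : ∀ β γ d x →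
                 ((if β then d else 1) ℕ.* (x ℕ.* (if γ then 1 else 1))) ÷ (if β then 1 else 1) ≡ x ℕ.* (if β then d else 1)
÷-slot-trivial β γ d x rewrite if-eta β {1} | if-eta γ {1} =
  trans (n/1≡n (s ℕ.* (x ℕ.* 1))) (trans (cong (s ℕ.*_) (ℕ.*-identityʳ x)) (ℕ.*-comm s x))
  where s = if β then d else 1

÷-slot-cancel : ∀ β d .{{_ : NonZero d}} x → ((if β then d else 1) ℕ.* x) ÷ (if β then d else 1) ≡ x
÷-slot-cancel true  d x = *÷-cancelˡ d x
÷-slot-cancel false d x = trans (n/1≡n (1 ℕ.* x)) (ℕ.*-identityˡ x)

module RingSums {r₁ r₂ : Level} (R : CommutativeRing r₁ r₂) where
  open CommutativeRing R hiding (zero) renaming (refl to ≈-refl; sym to ≈-sym; trans to ≈-trans)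
  open RingProperties ring using (-1*x≈-x; -‿involutive)
  open SetoidReasoning setoid

  ∑ : ℕ → (ℕ → Carrier) → Carrier
  ∑ zero    f = 0#
  ∑ (suc n) f = ∑ n f + f n

  infixl 10 ∑
  syntax ∑ n (λ i → x) = ∑[ i < n ] x

  ∑-cong : ∀ n {f f′ : ℕ → Carrier} → (∀ i → i < n → f i ≈ f′ i) → ∑ n f ≈ ∑ n f′
  ∑-cong zero    f≈f′ = ≈-refl
  ∑-cong (suc n) f≈f′ = +-cong (∑-cong n (λ i i<n → f≈f′ i (m<n⇒m<1+n i<n))) (f≈f′ n ≤-refl)

  ∑-head : ∀ n (f : ℕ → Carrier) → ∑ (suc n) f ≈ f 0 + ∑[ i < n ] f (suc i)
  ∑-head zero    f = ≈-trans (+-identityˡ _) (≈-sym (+-identityʳ _))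
  ∑-head (suc n) f = ≈-trans (+-congʳ (∑-head n f)) (+-assoc _ _ _)

  ∑-truncate : ∀ {s L} (f : ℕ → Carrier) → s ≤ L → (∀ i → s ≤ i → f i ≈ 0#) → ∑ L f ≈ ∑ s f
  ∑-truncate {L = zero}  f z≤n  f≈0 = ≈-refl
  ∑-truncate {L = suc L} f s≤1+L f≈0 with m≤n⇒m<n∨m≡n s≤1+L
  ... | inj₂ refl       = ≈-refl
  ... | inj₁ (s≤s s≤L) = ≈-trans (+-cong (∑-truncate f s≤L f≈0) (f≈0 L s≤L)) (+-identityʳ _)

  ∑-distrib-+ : ∀ n (f f′ : ℕ → Carrier) → ∑[ i < n ] (f i + f′ i) ≈ ∑ n f + ∑ n f′
  ∑-distrib-+ zero    f f′ = ≈-sym (+-identityˡ 0#)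
  ∑-distrib-+ (suc n) f f′ = ≈-trans (+-congʳ (∑-distrib-+ n f f′)) (+-assoc-middle _ _ _ _)
    where
    +-assoc-middle : ∀ w x y z → (w + x) + (y + z) ≈ (w + y) + (x + z)
    +-assoc-middle w x y z = begin
      (w + x) + (y + z) ≈⟨ +-assoc w x (y + z) ⟩
      w + (x + (y + z)) ≈⟨ +-congˡ (x+[y+z]≈y+[x+z]) ⟩
      w + (y + (x + z)) ≈⟨ +-assoc w y (x + z) ⟨
      (w + y) + (x + z) ∎
      where
      x+[y+z]≈y+[x+z] : x + (y + z) ≈ y + (x + z)
      x+[y+z]≈y+[x+z] = ≈-trans (≈-sym (+-assoc x y z)) (≈-trans (+-congʳ (+-comm x y)) (+-assoc y x z))

  ∑-comm : ∀ m n (f : ℕ → ℕ → Carrier) → ∑[ i < m ] ∑[ j < n ] f i j ≈ ∑[ j < n ] ∑[ i < m ] f i j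
  ∑-comm zero    n f = ≈-sym (∑-truncate {L = n} (λ _ → 0#) z≤n (λ _ _ → ≈-refl))
  ∑-comm (suc m) n f = ≈-trans (+-congʳ (∑-comm m n f)) (≈-sym (∑-distrib-+ n _ _))

  *-distribˡ-∑ : ∀ n x (f : ℕ → Carrier) → x * ∑ n f ≈ ∑[ i < n ] (x * f i)
  *-distribˡ-∑ zero    x f = zeroʳ x
  *-distribˡ-∑ (suc n) x f = ≈-trans (distribˡ x _ _) (+-congʳ (*-distribˡ-∑ n x f))

  rsum-++ : ∀ xs ys → rsum R (xs ++ ys) ≈ rsum R xs + rsum R ys
  rsum-++ []       ys = ≈-sym (+-identityˡ _)
  rsum-++ (x ∷ xs) ys = ≈-trans (+-congˡ (rsum-++ xs ys)) (≈-sym (+-assoc _ _ _))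

  rsum-map-concatMap : ∀ {A B : Set} (F : B → Carrier) (f : A → List B) xs →
                       rsum R (map F (concatMap f xs)) ≈ rsum R (map (λ x → rsum R (map F (f x))) xs)
  rsum-map-concatMap F f []       = ≈-refl
  rsum-map-concatMap F f (x ∷ xs) = begin
    rsum R (map F (f x ++ concatMap f xs))        ≡⟨ cong (rsum R) (map-++ F (f x) _) ⟩
    rsum R (map F (f x) ++ map F (concatMap f xs)) ≈⟨ rsum-++ (map F (f x)) _ ⟩
    rsum R (map F (f x)) + rsum R (map F (concatMap f xs)) ≈⟨ +-congˡ (rsum-map-concatMap F f xs) ⟩
    rsum R (map F (f x)) + rsum R (map (λ x → rsum R (map F (f x))) xs) ∎

  *-distribˡ-rsum : ∀ x ys → x * rsum R ys ≈ rsum R (map (x *_) ys)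
  *-distribˡ-rsum x []       = zeroʳ x
  *-distribˡ-rsum x (y ∷ ys) = ≈-trans (distribˡ x y _) (+-congˡ (*-distribˡ-rsum x ys))

  rsum-applyUpTo : ∀ (f : ℕ → Carrier) n → rsum R (applyUpTo f n) ≈ ∑ n f
  rsum-applyUpTo f zero    = ≈-refl
  rsum-applyUpTo f (suc n) = ≈-trans (+-congˡ (rsum-applyUpTo (f ∘ suc) n)) (≈-sym (∑-head n f))

  rsum-map-range1 : ∀ (F : ℕ → Carrier) L → rsum R (map F (range 1 L)) ≈ ∑[ i < L ] F (suc i)
  rsum-map-range1 F L = ≈-trans (reflexive (cong (rsum R) map-range1)) (rsum-applyUpTo (F ∘ suc) L)
    where
    map-range1 : map F (range 1 L) ≡ applyUpTo (F ∘ suc) L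
    map-range1 = trans (cong (map F) (map-applyUpTo id suc L)) (map-applyUpTo suc F L)

  rsum-map-unique-set : ∀ {A : Set} (F : A → Carrier) {xs ys : List A} →
                        Unique xs → Unique ys → xs ∼[ set ] ys → rsum R (map F xs) ≈ rsum R (map F ys)
  rsum-map-unique-set F xs! ys! xs∼ys = foldr-commMonoid setoid +-isCommutativeMonoid
    (↭⇒↭ₛ′ isEquivalence (↭-map⁺ F (∼bag⇒↭ (unique∧set⇒bag xs! ys! xs∼ys))))

  negOnePow-suc : ∀ k x → negOnePow R (suc k) * x ≈ - (negOnePow R k * x)
  negOnePow-suc k x = ≈-trans (*-assoc (- 1#) _ x) (-1*x≈-x _)

  negOnePow-suc-suc : ∀ k x → negOnePow R (suc (suc k)) * x ≈ negOnePow R k * x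
  negOnePow-suc-suc k x = ≈-trans (negOnePow-suc (suc k) x) (≈-trans (-‿cong (negOnePow-suc k x)) (-‿involutive _))

  ∑-alternating-telescope : ∀ n (a : ℕ → Carrier) →
                            ∑[ i < n ] (negOnePow R i * (a i + a (suc i))) ≈ a 0 + negOnePow R (suc n) * a n
  ∑-alternating-telescope zero a = ≈-sym (begin
    a 0 + negOnePow R 1 * a 0 ≈⟨ +-congˡ (negOnePow-suc 0 (a 0)) ⟩
    a 0 - 1# * a 0            ≈⟨ +-congˡ (-‿cong (*-identityˡ (a 0))) ⟩
    a 0 - a 0                 ≈⟨ -‿inverseʳ (a 0) ⟩
    0#                        ∎)
  ∑-alternating-telescope (suc n) a = begin
    ∑[ i < n ] (negOnePow R i * (a i + a (suc i))) + σ * (a n + a (suc n))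
      ≈⟨ +-cong (∑-alternating-telescope n a) (distribˡ σ (a n) (a (suc n))) ⟩
    (a 0 + negOnePow R (suc n) * a n) + (σ * a n + σ * a (suc n))
      ≈⟨ +-congʳ (+-congˡ (negOnePow-suc n (a n))) ⟩
    (a 0 - σ * a n) + (σ * a n + σ * a (suc n))
      ≈⟨ x-y+[y+z]≈x+z (a 0) (σ * a n) (σ * a (suc n)) ⟩
    a 0 + σ * a (suc n)
      ≈⟨ +-congˡ (negOnePow-suc-suc n (a (suc n))) ⟨
    a 0 + negOnePow R (suc (suc n)) * a (suc n) ∎
    where
    σ = negOnePow R n
    x-y+[y+z]≈x+z : ∀ x y z → (x - y) + (y + z) ≈ x + z
    x-y+[y+z]≈x+z x y z = begin
      (x - y) + (y + z) ≈⟨ +-assoc x (- y) (y + z) ⟩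
      x + (- y + (y + z)) ≈⟨ +-congˡ (+-assoc (- y) y z) ⟨
      x + ((- y + y) + z) ≈⟨ +-congˡ (+-congʳ (-‿inverseˡ y)) ⟩
      x + (0# + z)        ≈⟨ +-congˡ (+-identityˡ z) ⟩
      x + z ∎

module CompositionSums {r₁ r₂ : Level} (R : CommutativeRing r₁ r₂) (g : ℕ → CommutativeRing.Carrier R) where
  open CommutativeRing R hiding (zero) renaming (refl to ≈-refl; sym to ≈-sym; trans to ≈-trans)
  open RingSums R
  open SetoidReasoning setoid

  weight : List ℕ → Carrier
  weight is = rprod R (map g is)

  compositionSum : ℕ → Carrier
  compositionSum ℓ = rsum R (map weight (compositions ℓ))

  tupleSum : List ℕ → ℕ → ℕ → Carrier
  tupleSum ds r s = rsum R (map weight (filter (λ c → sum c ≟ s) (tuples r ds)))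

  exactPartsSum : ℕ → ℕ → Carrier
  exactPartsSum zero    zero    = 1#
  exactPartsSum zero    (suc _) = 0#
  exactPartsSum (suc r) s       = ∑[ i < s ] (g (suc i) * exactPartsSum r (s ∸ suc i))

  boundedPartsSum : ℕ → ℕ → Carrier
  boundedPartsSum k s = ∑[ r < suc k ] exactPartsSum r s

  rsum-weight-cons : ∀ d xs → rsum R (map weight (map (d ∷_) xs)) ≈ g d * rsum R (map weight xs)
  rsum-weight-cons d xs =
    ≈-trans (reflexive (cong (rsum R) (trans (sym (map-∘ {g = weight} xs)) (map-∘ {g = g d *_} {f = weight} xs))))
            (≈-sym (*-distribˡ-rsum (g d) (map weight xs)))

  tupleSum-range1 : ∀ r {s L} → s ≤ L → tupleSum (range 1 L) r s ≈ exactPartsSum r s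
  tupleSum-range1 zero    {zero}  _   = +-identityʳ 1#
  tupleSum-range1 zero    {suc s} _   = ≈-refl
  tupleSum-range1 (suc r) {s} {L} s≤L = begin
    tupleSum D (suc r) s
      ≡⟨ cong (rsum R ∘ map weight) (filter-concatMap (λ c → sum c ≟ s) (λ d → map (d ∷_) T) D) ⟩
    rsum R (map weight (concatMap (λ d → filter (λ c → sum c ≟ s) (map (d ∷_) T)) D))
      ≈⟨ rsum-map-concatMap weight (λ d → filter (λ c → sum c ≟ s) (map (d ∷_) T)) D ⟩
    rsum R (map term D)
      ≈⟨ rsum-map-range1 term L ⟩
    ∑[ i < L ] term (suc i)
      ≈⟨ ∑-truncate (term ∘ suc) s≤L term-vanishes ⟩
    ∑[ i < s ] term (suc i)
      ≈⟨ ∑-cong s term≈ ⟩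
    exactPartsSum (suc r) s ∎
    where
    D = range 1 L
    T = tuples r D
    term : ℕ → Carrier
    term d = rsum R (map weight (filter (λ c → sum c ≟ s) (map (d ∷_) T)))
    term-cons : ∀ d → term d ≈ g d * rsum R (map weight (filter (λ c → d ℕ.+ sum c ≟ s) T))
    term-cons d = ≈-trans (reflexive (cong (rsum R ∘ map weight) (filter-map (λ c → sum c ≟ s) (d ∷_) T)))
                          (rsum-weight-cons d (filter (λ c → d ℕ.+ sum c ≟ s) T))
    term-vanishes : ∀ i → s ≤ i → term (suc i) ≈ 0#
    term-vanishes i s≤i = ≈-trans (term-cons (suc i)) (≈-trans (*-congˡ (reflexive (cong (rsum R ∘ map weight)
      (filter-none (λ c → suc i ℕ.+ sum c ≟ s) (universal (λ c eq → <⇒≢ (s<1+i+c c) (sym eq)) T)))))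
      (zeroʳ _))
      where
      s<1+i+c : ∀ c → s < suc i ℕ.+ sum c
      s<1+i+c c = s≤s (≤-trans s≤i (m≤m+n i (sum c)))
    term≈ : ∀ i → i < s → term (suc i) ≈ g (suc i) * exactPartsSum r (s ∸ suc i)
    term≈ i i<s = ≈-trans (term-cons (suc i)) (*-congˡ (≈-trans
      (reflexive (cong (rsum R ∘ map weight) (filter-≐ (λ c → suc i ℕ.+ sum c ≟ s) (λ c → sum c ≟ s ∸ suc i) sum≐ T)))
      (tupleSum-range1 r (≤-trans (m∸n≤m s (suc i)) s≤L))))
      where
      sum≐ : (λ c → suc i ℕ.+ sum c ≡ s) ≐ (λ c → sum c ≡ s ∸ suc i)
      sum≐ = (λ {c} eq → trans (sym (m+n∸m≡n (suc i) (sum c))) (cong (_∸ suc i) eq))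
           , (λ eq → trans (cong (suc i ℕ.+_) eq) (m+[n∸m]≡n i<s))

  boundedPartsSum-suc : ∀ k s → boundedPartsSum (suc k) s ≈
                        exactPartsSum 0 s + ∑[ i < s ] (g (suc i) * boundedPartsSum k (s ∸ suc i))
  boundedPartsSum-suc k s = begin
    boundedPartsSum (suc k) s
      ≈⟨ ∑-head (suc k) (λ r → exactPartsSum r s) ⟩
    exactPartsSum 0 s + ∑[ r < suc k ] ∑[ i < s ] (g (suc i) * exactPartsSum r (s ∸ suc i))
      ≈⟨ +-congˡ (∑-comm (suc k) s (λ r i → g (suc i) * exactPartsSum r (s ∸ suc i))) ⟩
    exactPartsSum 0 s + ∑[ i < s ] ∑[ r < suc k ] (g (suc i) * exactPartsSum r (s ∸ suc i))
      ≈⟨ +-congˡ (∑-cong s (λ i _ → *-distribˡ-∑ (suc k) (g (suc i)) (λ r → exactPartsSum r (s ∸ suc i)))) ⟨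
    exactPartsSum 0 s + ∑[ i < s ] (g (suc i) * boundedPartsSum k (s ∸ suc i)) ∎

  module _ (N : ℕ) (E : ℕ → Carrier) (E₀ : E 0 ≈ 1#)
           (E-rec : ∀ s → 1 ≤ s → s ≤ N → E s ≈ ∑[ i < s ] (g (suc i) * E (s ∸ suc i))) where

    boundedPartsSum≈ : ∀ k s → s ≤ k → s ≤ N → boundedPartsSum k s ≈ E s
    boundedPartsSum≈ zero    zero    _         _   = ≈-trans (+-identityˡ 1#) (≈-sym E₀)
    boundedPartsSum≈ (suc k) zero    _         _   =
      ≈-trans (boundedPartsSum-suc k 0) (≈-trans (+-identityʳ 1#) (≈-sym E₀))
    boundedPartsSum≈ (suc k) (suc s) (s≤s s≤k) s<N = begin
      boundedPartsSum (suc k) (suc s)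
        ≈⟨ boundedPartsSum-suc k (suc s) ⟩
      0# + ∑[ i < suc s ] (g (suc i) * boundedPartsSum k (s ∸ i))
        ≈⟨ +-identityˡ _ ⟩
      ∑[ i < suc s ] (g (suc i) * boundedPartsSum k (s ∸ i))
        ≈⟨ ∑-cong (suc s) (λ i _ → *-congˡ (boundedPartsSum≈ k (s ∸ i) (s∸i≤ i s≤k) (s∸i≤ i (<⇒≤ s<N)))) ⟩
      ∑[ i < suc s ] (g (suc i) * E (s ∸ i))
        ≈⟨ E-rec (suc s) (s≤s z≤n) s<N ⟨
      E (suc s) ∎
      where
      s∸i≤ : ∀ i {b} → s ≤ b → s ∸ i ≤ b
      s∸i≤ i = ≤-trans (m∸n≤m s i)

    compositionSum≈ : ∀ ℓ → 1 ≤ ℓ → ℓ ≤ N → compositionSum ℓ ≈ E ℓ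
    compositionSum≈ ℓ@(suc l) _ ℓ≤N = begin
      compositionSum ℓ
        ≡⟨ cong (rsum R ∘ map weight) (filter-concatMap (λ c → sum c ≟ ℓ) (λ r → tuples r D) D) ⟩
      rsum R (map weight (concatMap (λ r → filter (λ c → sum c ≟ ℓ) (tuples r D)) D))
        ≈⟨ rsum-map-concatMap weight (λ r → filter (λ c → sum c ≟ ℓ) (tuples r D)) D ⟩
      rsum R (map (λ r → tupleSum D r ℓ) D)
        ≈⟨ rsum-map-range1 (λ r → tupleSum D r ℓ) ℓ ⟩
      ∑[ r < ℓ ] tupleSum D (suc r) ℓ
        ≈⟨ ∑-cong ℓ (λ r _ → tupleSum-range1 (suc r) {ℓ} ≤-refl) ⟩
      ∑[ r < ℓ ] exactPartsSum (suc r) ℓ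
        ≈⟨ +-identityˡ _ ⟨
      exactPartsSum 0 ℓ + ∑[ r < ℓ ] exactPartsSum (suc r) ℓ
        ≈⟨ ∑-head ℓ (λ r → exactPartsSum r ℓ) ⟨
      boundedPartsSum ℓ ℓ
        ≈⟨ boundedPartsSum≈ ℓ ℓ ≤-refl ℓ≤N ⟩
      E ℓ ∎
      where
      D = range 1 ℓ

module Hecke {r₁ r₂ : Level} (R : CommutativeRing r₁ r₂) (N p : ℕ) (p-prime : Prime p)
             (A : Vec ℕ N → CommutativeRing.Carrier R) (hecke : HeckeRelation R (suc N) A) where
  open CommutativeRing R hiding (zero) renaming (refl to ≈-refl; sym to ≈-sym; trans to ≈-trans)
  open RingSums R
  open RingProperties ring using (//-rightDividesʳ)
  open SetoidReasoning setoid

  instance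
    p≢0 : NonZero p
    p≢0 = prime⇒nonZero p-prime

  h : ℕ → Carrier
  h i = A (firstIx (suc N) (p ^ i))

  e : ℕ → Carrier
  e k = A (slotIx (suc N) k p)

  slotEntry : ℕ → ℕ → ℕ
  slotEntry k j = if suc j ≡ᵇ k then p else 1

  -- Under the Satake isomorphism A(hookIx i k) is the Schur polynomial of the hook (i+1, 1^(k-1)).
  hookIx : ℕ → ℕ → Vec ℕ N
  hookIx i k = tabulate (λ j → headOr1 (p ^ i) (toℕ j) ℕ.* slotEntry k (toℕ j))

  hook : ℕ → ℕ → Carrier
  hook i k = A (hookIx i k)

  hookIx-zero : ∀ k → hookIx 0 k ≡ slotIx (suc N) k p
  hookIx-zero k = tabulate-cong (λ j → entry (toℕ j))
    where
    entry : ∀ j → headOr1 1 j ℕ.* slotEntry k j ≡ slotEntry k j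
    entry zero    = ℕ.*-identityˡ _
    entry (suc j) = ℕ.*-identityˡ _

  hookIx-one : ∀ i → hookIx i 1 ≡ firstIx (suc N) (p ^ suc i)
  hookIx-one i = trans (tabulate-cong (λ j → entry (toℕ j))) (sym (firstIx-suc N (p ^ suc i)))
    where
    entry : ∀ j → headOr1 (p ^ i) j ℕ.* slotEntry 1 j ≡ headOr1 (p ^ suc i) j
    entry zero    = ℕ.*-comm (p ^ i) p
    entry (suc j) = refl

  -- The Hecke relation for m = p^(i+1) at the slot index of e_(K+1): its only admissible
  -- tuples are t₁ = (1,…,1,m) and t₂, which has p in slot K+1 and p^i last.
  module Pieri (i K : ℕ) (K<N : K < N) where
    m : ℕ
    m = p ^ suc i

    mv : Vec ℕ N
    mv = slotIx (suc N) (suc K) p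

    M : ℕ
    M = N ∸ suc K

    K+1+M≡N : K ℕ.+ suc M ≡ N
    K+1+M≡N = trans (ℕ.+-suc K M) (m+[n∸m]≡n K<N)

    tuple : ℕ → ℕ → List ℕ
    tuple = heckeTuple K M

    t₁ t₂ : List ℕ
    t₁ = tuple 1 m
    t₂ = tuple p (p ^ i)

    isHecke? : Decidable (λ c → product c ≡ m × (∀ j → getD c (toℕ j) ∣ lookup mv j))
    isHecke? c = (product c ≟ m) ×-dec all? (λ j → getD c (toℕ j) ∣? lookup mv j)

    getD-tuple : ∀ a b {j} → j < N → getD (tuple a b) j ≡ (if does (j ≟ K) then a else 1)
    getD-tuple a b {j} j<N with j ≟ K
    ... | yes refl = trans (getD-heckeTuple-slot K M a b) (sym (if-≟-refl K))
    ... | no  j≢K  = trans (getD-heckeTuple-other K M a b j≢K (<⇒≢ (subst (j <_) (sym K+1+M≡N) j<N)))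
                           (sym (if-≟-≢ j≢K))

    getD-tuple-prev : ∀ a b {j} → j < N →
                      getD (tuple a b) (prevIx (suc N) j) ≡ headOr1 b j ℕ.* (if does (j ≟ suc K) then a else 1)
    getD-tuple-prev a b {zero}  _   =
      trans (subst (λ n → getD (tuple a b) n ≡ b) K+1+M≡N (getD-heckeTuple-last K M a b)) (sym (ℕ.*-identityʳ b))
    getD-tuple-prev a b {suc j} j<N = trans (getD-tuple a b (<⇒≤ j<N)) (sym (ℕ.*-identityˡ _))

    heckeIndex-tuple : ∀ a b → heckeIndex (suc N) mv (tuple a b) ≡
      tabulate (λ j → (slotEntry (suc K) (toℕ j) ℕ.* (headOr1 b (toℕ j) ℕ.* (if does (toℕ j ≟ suc K) then a else 1)))
                      ÷ (if does (toℕ j ≟ K) then a else 1))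
    heckeIndex-tuple a b = tabulate-cong (λ j →
      cong₂ _÷_ (cong₂ ℕ._*_ (lookup∘tabulate _ j) (getD-tuple-prev a b (toℕ<n j))) (getD-tuple a b (toℕ<n j)))

    heckeIndex-t₁ : heckeIndex (suc N) mv t₁ ≡ hookIx (suc i) (suc K)
    heckeIndex-t₁ = trans (heckeIndex-tuple 1 m)
      (tabulate-cong (λ j → ÷-slot-trivial (does (toℕ j ≟ K)) (does (toℕ j ≟ suc K)) p (headOr1 m (toℕ j))))

    heckeIndex-t₂ : heckeIndex (suc N) mv t₂ ≡ hookIx i (suc (suc K))
    heckeIndex-t₂ = trans (heckeIndex-tuple p (p ^ i)) (tabulate-cong (λ j → ÷-slot-cancel (does (toℕ j ≟ K)) p _))

    instance
      m≢0 : NonZero m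
      m≢0 = m^n≢0 p (suc i)

    getD∣slotEntry : ∀ {c} → (∀ j → getD c (toℕ j) ∣ lookup mv j) →
                     ∀ {j} → j < N → getD c j ∣ slotEntry (suc K) j
    getD∣slotEntry {c} c∣mv {j} j<N = subst₂ (λ u v → getD c u ∣ v) (toℕ-fromℕ< j<N)
      (trans (lookup∘tabulate _ (fromℕ< j<N)) (cong (slotEntry (suc K)) (toℕ-fromℕ< j<N)))
      (c∣mv (fromℕ< j<N))

    heckeTuple-shape : ∀ {c} → c ∈ heckeTuples (suc N) m mv → c ≡ t₁ ⊎ c ≡ t₂
    heckeTuple-shape {c} c∈ with ∈-filter⁻ isHecke? {xs = tuples (suc N) (divisors m)} c∈
    ... | c∈tuples , product≡m , c∣mv = finish (prime⇒irreducible p-prime c[K]∣p)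
      where
      c[K]∣p : getD c K ∣ p
      c[K]∣p = subst (getD c K ∣_) (if-≟-refl K) (getD∣slotEntry {c} c∣mv K<N)
      ones : ∀ j → j < K ℕ.+ suc M → j ≢ K → getD c j ≡ 1
      ones j j<N j≢K = ∣1⇒≡1 (subst (getD c j ∣_) (if-≟-≢ j≢K) (getD∣slotEntry {c} c∣mv (subst (j <_) K+1+M≡N j<N)))
      c≡tuple : c ≡ tuple (getD c K) (getD c N)
      c≡tuple = subst (λ n → c ≡ tuple (getD c K) (getD c n)) K+1+M≡N
        (≡-heckeTuple K M (trans (∈-tuples⇒length (suc N) (divisors m) c∈tuples) (cong suc (sym K+1+M≡N))) ones)
      c[K]*c[N]≡m : getD c K ℕ.* getD c N ≡ m
      c[K]*c[N]≡m = trans (sym (product-heckeTuple K M _ _)) (trans (cong product (sym c≡tuple)) product≡m)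
      finish : getD c K ≡ 1 ⊎ getD c K ≡ p → c ≡ t₁ ⊎ c ≡ t₂
      finish (inj₁ c[K]≡1) = inj₁ (trans c≡tuple (cong₂ tuple c[K]≡1
        (trans (sym (ℕ.*-identityˡ _)) (trans (cong (ℕ._* getD c N) (sym c[K]≡1)) c[K]*c[N]≡m))))
      finish (inj₂ c[K]≡p) = inj₂ (trans c≡tuple (cong₂ tuple c[K]≡p
        (ℕ.*-cancelˡ-≡ _ _ p (trans (cong (ℕ._* getD c N) (sym c[K]≡p)) c[K]*c[N]≡m))))

    tuple∈heckeTuples : ∀ {a b} → a ∣ p → a ℕ.* b ≡ m → tuple a b ∈ heckeTuples (suc N) m mv
    tuple∈heckeTuples {a} {b} a∣p a*b≡m =
      ∈-filter⁺ isHecke? tuple∈tuples (trans (product-heckeTuple K M a b) a*b≡m , tuple∣mv)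
      where
      a∣m : a ∣ m
      a∣m = ∣-trans a∣p (m∣m*n (p ^ i))
      b∣m : b ∣ m
      b∣m = divides a (sym a*b≡m)
      tuple∈tuples : tuple a b ∈ tuples (suc N) (divisors m)
      tuple∈tuples = subst (λ l → tuple a b ∈ tuples l (divisors m))
        (trans (length-heckeTuple K M a b) (cong suc K+1+M≡N))
        (∈-tuples (All-heckeTuple K M (∈-divisors (1∣ m)) (∈-divisors a∣m) (∈-divisors b∣m)))
      if-∣ : ∀ β → (if β then a else 1) ∣ (if β then p else 1)
      if-∣ true  = a∣p
      if-∣ false = ∣-refl
      tuple∣mv : ∀ j → getD (tuple a b) (toℕ j) ∣ lookup mv j
      tuple∣mv j = subst₂ _∣_ (sym (getD-tuple a b (toℕ<n j))) (sym (lookup∘tabulate _ j)) (if-∣ (does (toℕ j ≟ K)))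

    t₁≢t₂ : t₁ ≢ t₂
    t₁≢t₂ t₁≡t₂ = ¬prime[1] (subst Prime (sym 1≡p) p-prime)
      where
      1≡p : 1 ≡ p
      1≡p = trans (sym (getD-heckeTuple-slot K M 1 m))
                  (trans (cong (λ c → getD c K) t₁≡t₂) (getD-heckeTuple-slot K M p (p ^ i)))

    heckeTuples∼[t₁,t₂] : heckeTuples (suc N) m mv ∼[ set ] t₁ ∷ t₂ ∷ []
    heckeTuples∼[t₁,t₂] = mk⇔ to from
      where
      to : ∀ {c} → c ∈ heckeTuples (suc N) m mv → c ∈ t₁ ∷ t₂ ∷ []
      to c∈ with heckeTuple-shape c∈
      ... | inj₁ refl = here refl
      ... | inj₂ refl = there (here refl)
      from : ∀ {c} → c ∈ t₁ ∷ t₂ ∷ [] → c ∈ heckeTuples (suc N) m mv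
      from (here refl)         = tuple∈heckeTuples (1∣ p) (ℕ.*-identityˡ m)
      from (there (here refl)) = tuple∈heckeTuples ∣-refl refl

    pieri : h (suc i) * e (suc K) ≈ hook (suc i) (suc K) + hook i (suc (suc K))
    pieri = begin
      h (suc i) * e (suc K)
        ≈⟨ hecke m (m^n>0 p (suc i)) mv mv≥1 ⟩
      rsum R (map F (heckeTuples (suc N) m mv))
        ≈⟨ rsum-map-unique-set F heckeTuples-unique ((t₁≢t₂ ∷ []) ∷ [] ∷ []) heckeTuples∼[t₁,t₂] ⟩
      F t₁ + (F t₂ + 0#)
        ≈⟨ +-cong (reflexive (cong A heckeIndex-t₁)) (≈-trans (+-identityʳ _) (reflexive (cong A heckeIndex-t₂))) ⟩
      hook (suc i) (suc K) + hook i (suc (suc K)) ∎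
      where
      F : List ℕ → Carrier
      F c = A (heckeIndex (suc N) mv c)
      heckeTuples-unique : Unique (heckeTuples (suc N) m mv)
      heckeTuples-unique = Unique.filter⁺ isHecke? (tuples-unique (suc N) (divisors-unique m))
      if-≥1 : ∀ β → 1 ≤ (if β then p else 1)
      if-≥1 true  = >-nonZero⁻¹ p
      if-≥1 false = ≤-refl
      mv≥1 : ∀ j → 1 ≤ lookup mv j
      mv≥1 j = subst (1 ≤_) (sym (lookup∘tabulate _ j)) (if-≥1 (does (toℕ j ≟ K)))

  pieri : ∀ i {k} → 1 ≤ k → k ≤ N → h (suc i) * e k ≈ hook (suc i) k + hook i (suc k)
  pieri i {suc K} _ k≤N = Pieri.pieri i K k≤N

  g : ℕ → Carrier
  g i = negOnePow R (suc i) * h i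

  E : ℕ → Carrier
  E zero      = 1#
  E k@(suc _) = e k

  E-recursion : ∀ s → 1 ≤ s → s ≤ N → E s ≈ ∑[ i < s ] (g (suc i) * E (s ∸ suc i))
  E-recursion (suc t) _ t<N = ≈-sym (begin
    ∑[ i < t ] (g (suc i) * E (t ∸ i)) + g (suc t) * E (t ∸ t)
      ≈⟨ +-cong (∑-cong t term≈) last≈ ⟩
    ∑[ i < t ] (negOnePow R i * (a i + a (suc i))) + σ′ * a t
      ≈⟨ +-congʳ (∑-alternating-telescope t a) ⟩
    a 0 + σ * a t + σ′ * a t
      ≈⟨ +-congˡ (negOnePow-suc (suc t) (a t)) ⟩
    a 0 + σ * a t - σ * a t
      ≈⟨ //-rightDividesʳ (σ * a t) (a 0) ⟩
    a 0
      ≡⟨ cong A (hookIx-zero (suc t)) ⟩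
    e (suc t) ∎)
    where
    σ σ′ : Carrier
    σ  = negOnePow R (suc t)
    σ′ = negOnePow R (suc (suc t))
    a : ℕ → Carrier
    a i = hook i (suc t ∸ i)
    term≈ : ∀ i → i < t → g (suc i) * E (t ∸ i) ≈ negOnePow R i * (a i + a (suc i))
    term≈ i i<t = begin
      negOnePow R (suc (suc i)) * h (suc i) * E (t ∸ i)
        ≈⟨ *-assoc _ _ _ ⟩
      negOnePow R (suc (suc i)) * (h (suc i) * E k)
        ≈⟨ negOnePow-suc-suc i _ ⟩
      negOnePow R i * (h (suc i) * E k)
        ≡⟨ cong (λ x → negOnePow R i * (h (suc i) * x)) (E-pos 1≤k) ⟩
      negOnePow R i * (h (suc i) * e k)
        ≈⟨ *-congˡ (≈-trans (pieri i 1≤k k≤N) (+-comm _ _)) ⟩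
      negOnePow R i * (hook i (suc k) + hook (suc i) k)
        ≡⟨ cong (λ l → negOnePow R i * (hook i l + a (suc i))) (sym (+-∸-assoc 1 (<⇒≤ i<t))) ⟩
      negOnePow R i * (a i + a (suc i)) ∎
      where
      k = t ∸ i
      1≤k : 1 ≤ k
      1≤k = m<n⇒0<n∸m i<t
      k≤N : k ≤ N
      k≤N = ≤-trans (m∸n≤m t i) (<⇒≤ t<N)
      E-pos : ∀ {k} → 1 ≤ k → E k ≡ e k
      E-pos {suc _} _ = refl
    last≈ : g (suc t) * E (t ∸ t) ≈ σ′ * a t
    last≈ = begin
      g (suc t) * E (t ∸ t) ≡⟨ cong (λ k → g (suc t) * E k) (n∸n≡0 t) ⟩
      g (suc t) * 1#        ≈⟨ *-identityʳ _ ⟩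
      σ′ * h (suc t)        ≡⟨ cong (λ v → σ′ * A v) (sym (trans (cong (hookIx t) (m+n∸n≡m 1 t)) (hookIx-one t))) ⟩
      σ′ * a t ∎

proposition3p1 : {a r : Level} (R : CommutativeRing a r) (n ℓ p : ℕ) → 2 ≤ n → 1 ≤ ℓ → ℓ ≤ n ∸ 1 → Prime p →
    (A : Vec ℕ (n ∸ 1) → CommutativeRing.Carrier R) →
    HeckeRelation R n A →
    CommutativeRing._≈_ R (A (replicate (n ∸ 1) 1)) (CommutativeRing.1# R) →
    CommutativeRing._≈_ R (A (slotIx n ℓ p))
      (rsum R (map (λ is → rprod R (map (λ i → CommutativeRing._*_ R (negOnePow R (ℕ.suc i)) (A (firstIx n (p ^ i)))) is)) (compositions ℓ)))
proposition3p1 R (suc N) ℓ@(suc _) p _ 1≤ℓ ℓ≤N p-prime A hecke _ =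
  CommutativeRing.sym R (compositionSum≈ N E (CommutativeRing.refl R) E-recursion ℓ 1≤ℓ ℓ≤N)
  where
  open Hecke R N p p-prime A hecke
  open CompositionSums R g
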